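{- Let $r$ be a positive integer. There exist constants $c_1,c_2>0$ such that for all prime powers $q$, $$c_1q^{r^2-1}\le\#S(\mathrm{GL}(r,\mathbb{F}_q),\mathbb{F}_q^r)\le c_2q^{r^2-1}.$$ Consequently there exist constants $c_1',c_2'>0$ such that for all prime powers $q$, $$\frac{c_1'}{q}\le\frac{\#S(\mathrm{GL}(r,\mathbb{F}_q),\mathbb{F}_q^r)}{\#\mathrm{GL}(r,\mathbb{F}_q)}\le\frac{c_2'}{q}.$$
   Context: $S(\mathrm{GL}(r,\mathbb{F}_q),\mathbb{F}_q^r)$ denotes the set of matrices $g\in\mathrm{GL}(r,\mathbb{F}_q)$ for which there exists a non-zero $v\in\mathbb{F}_q^r$ with $gv=v$ (equivalently, $1$ is an eigenvalue of $g$). -}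

module Defs where

open import Level using (0ℓ)
open import Data.Nat using (ℕ; zero; suc)
open import Data.Fin using (Fin; zero; suc)
open import Data.Product using (Σ; ∃; _×_; _,_)
open import Data.Unit using (⊤)
open import Relation.Nullary using (¬_)
open import Relation.Binary.PropositionalEquality using (_≡_)
open import Algebra.Bundles using (CommutativeRing)

-- Cardinality of a subset P of a type A equipped with an equivalence _≈_
-- (counted up to _≈_):  "the set {a | P a} / ≈ has exactly n elements",
-- witnessed by an enumeration xs : Fin n → A which lists only elements of P,
-- is injective up to ≈, and hits every element of P up to ≈.
HasCard : {A : Set} → (A → A → Set) → (A → Set) → ℕ → Set
HasCard {A} _≈_ P n =
  Σ (Fin n → A) λ xs →
    (∀ i → P (xs i)) ×
    (∀ i j → xs i ≈ xs j → i ≡ j) ×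
    (∀ a → P a → ∃ λ i → a ≈ xs i)

record Field : Set₁ where
  field
    commRing : CommutativeRing 0ℓ 0ℓ
  open CommutativeRing commRing public
  field
    0≉1 : ¬ (0# ≈ 1#)
    inverse : ∀ x → ¬ (x ≈ 0#) → ∃ λ y → x * y ≈ 1#

FieldOfSize : Field → ℕ → Set
FieldOfSize F q = HasCard (Field._≈_ F) (λ _ → ⊤) q

module MatrixDefs (F : Field) where
  open Field F using (Carrier; _≈_; _+_; _*_; 0#; 1#)

  ∑ : (n : ℕ) → (Fin n → Carrier) → Carrier
  ∑ zero    f = 0#
  ∑ (suc n) f = f zero + ∑ n (λ i → f (suc i))

  Matrix : ℕ → Set
  Matrix r = Fin r → Fin r → Carrier

  Vector : ℕ → Set
  Vector r = Fin r → Carrier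

  _≈ₘ_ : {r : ℕ} → Matrix r → Matrix r → Set
  A ≈ₘ B = ∀ i j → A i j ≈ B i j

  _≈ᵥ_ : {r : ℕ} → Vector r → Vector r → Set
  u ≈ᵥ v = ∀ i → u i ≈ v i

  _·_ : {r : ℕ} → Matrix r → Matrix r → Matrix r
  _·_ {r} A B i j = ∑ r (λ k → A i k * B k j)

  _⊙_ : {r : ℕ} → Matrix r → Vector r → Vector r
  _⊙_ {r} A v i = ∑ r (λ k → A i k * v k)

  identity : {r : ℕ} → Matrix r
  identity {r} i j with i Data.Fin.≟ j
  ... | Relation.Nullary.yes _ = 1#
  ... | Relation.Nullary.no  _ = 0#

  zeroVec : {r : ℕ} → Vector r
  zeroVec _ = 0#

  InGL : {r : ℕ} → Matrix r → Set
  InGL {r} g = ∃ λ h → ((g · h) ≈ₘ identity) × ((h · g) ≈ₘ identity)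

  InS : {r : ℕ} → Matrix r → Set
  InS {r} g = InGL g × (∃ λ (v : Vector r) → ¬ (v ≈ᵥ zeroVec) × ((g ⊙ v) ≈ᵥ v))

CardGL : Field → ℕ → ℕ → Set
CardGL F r n = HasCard (MatrixDefs._≈ₘ_ F {r}) (MatrixDefs.InGL F) n

CardS : Field → ℕ → ℕ → Set
CardS F r n = HasCard (MatrixDefs._≈ₘ_ F {r}) (MatrixDefs.InS F) n

open import Data.Integer using (+_)
open import Data.Rational using (ℚ; _/_)

ℕtoℚ : ℕ → ℚ
ℕtoℚ n = (+ n) / 1

module Submission where

-- Write
-- r = n + 1.  Upper bounds: a g ∈ S fixes a vector with some coordinate j equal
-- to 1, and is then determined by j, the other coordinates of that vector and
-- the other columns, so #S ≤ r q^(r²-1) (UpperBoundS); and #GL ≤ q^(r²).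
-- Lower bounds: the products ( 1 0 ; w I ) ( a uᵀ ; 0 B ) with a ≠ 0 and
-- B ∈ GL(n, F) are pairwise distinct, so q^(r²) ≤ 2^r #GL (LowerBoundGL); the
-- conjugates of ( 1 uᵀ ; 0 B ) by ( 1 0 ; X I ) with B without fixed vector lie
-- in S and are pairwise distinct, and for q beyond a threshold most members of
-- the GL(n, F) family are such B, so q^(r²-1) ≤ 2^r #S (LowerBoundS).

open import Defs
open import Level using (0ℓ)
open import Data.Nat using (ℕ; zero; suc; _^_; _∸_; z≤n; s≤s)
  renaming (_+_ to _+ℕ_; _*_ to _*ℕ_; _≤_ to _≤ℕ_)
open import Data.Nat.Properties using (+-suc; +-monoʳ-≤)
open import Data.Fin using (Fin; zero; suc; punchIn; punchOut; combine; remQuot; funToFin; finToFun)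
import Data.Fin as Fin
open import Data.Fin.Properties
  using (suc-injective; injective⇒≤; punchInᵢ≢i; punchIn-punchOut; all?; any?; ¬∀⟶∃¬; combine-injective; combine-remQuot;
         funToFin-finToFin; finToFun-funToFin)
open import Data.Product using (Σ; ∃; _×_; _,_; proj₁; proj₂)
open import Data.Product.Relation.Binary.Pointwise.NonDependent using (_×ₛ_)
open import Data.Sum using (_⊎_; inj₁; inj₂)
open import Data.Unit using (⊤; tt)
open import Data.Empty using (⊥-elim)
open import Function using (_∘_)
open import Data.Vec.Functional using (_∷_)
import Data.Vec.Functional.Relation.Binary.Equality.Setoid
open import Relation.Nullary using (¬_; Dec; yes; no)
open import Relation.Nullary.Decidable using (¬?; _×-dec_)
open import Relation.Binary.Bundles using (Setoid)
import Relation.Binary.PropositionalEquality as ≡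
open ≡ using (_≡_)

module Counting where

  record Family (S : Setoid 0ℓ 0ℓ) (P : Setoid.Carrier S → Set) (m : ℕ) : Set where
    constructor family
    open Setoid S
    field
      member : Fin m → Carrier
      member-P : ∀ i → P (member i)
      member-injective : ∀ i j → member i ≈ member j → i ≡ j

  record Coding (S : Setoid 0ℓ 0ℓ) (P : Setoid.Carrier S → Set) (M : ℕ) : Set where
    constructor coding
    open Setoid S
    field
      code : ∀ a → P a → Fin M
      code-injective : ∀ a b p p′ → code a p ≡ code b p′ → a ≈ b

  module _ {S : Setoid 0ℓ 0ℓ} {P : Setoid.Carrier S → Set} where
    open Setoid S

    family≤coding : ∀ {m M} → Family S P m → Coding S P M → m ≤ℕ M
    family≤coding (family d Pd d-inj) (coding code code-inj) =
      injective⇒≤ λ {i} {j} e → d-inj i j (code-inj (d i) (d j) (Pd i) (Pd j) e)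

    card⇒family : ∀ {n} → HasCard _≈_ P n → Family S P n
    card⇒family (xs , Pxs , xs-inj , _) = family xs Pxs xs-inj

    card⇒coding : ∀ {n} → HasCard _≈_ P n → Coding S P n
    card⇒coding {n} (xs , _ , _ , onto) = coding position position-inj
      where
      position : ∀ a → P a → Fin n
      position a p = proj₁ (onto a p)

      position-inj : ∀ a b p p′ → position a p ≡ position b p′ → a ≈ b
      position-inj a b p p′ e =
        trans (proj₂ (onto a p)) (trans (reflexive (≡.cong xs e)) (sym (proj₂ (onto b p′))))

    family≤card : ∀ {m n} → Family S P m → HasCard _≈_ P n → m ≤ℕ n
    family≤card f h = family≤coding f (card⇒coding h)

    card≤coding : ∀ {n M} → HasCard _≈_ P n → Coding S P M → n ≤ℕ M
    card≤coding h = family≤coding (card⇒family h)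

  map-family : ∀ {S T : Setoid 0ℓ 0ℓ} {P Q m} (f : Setoid.Carrier S → Setoid.Carrier T) →
    (∀ a → P a → Q (f a)) →
    (∀ a b → P a → P b → Setoid._≈_ T (f a) (f b) → Setoid._≈_ S a b) →
    Family S P m → Family T Q m
  map-family f f-pres f-refl (family d Pd d-inj) =
    family (f ∘ d) (λ i → f-pres (d i) (Pd i)) λ i j e → d-inj i j (f-refl (d i) (d j) (Pd i) (Pd j) e)

  weaken : ∀ {S : Setoid 0ℓ 0ℓ} {P Q : Setoid.Carrier S → Set} {m} →
    (∀ {a} → P a → Q a) → Family S P m → Family S Q m
  weaken P⇒Q (family d Pd d-inj) = family d (P⇒Q ∘ Pd) d-inj

  _×-family_ : ∀ {S T : Setoid 0ℓ 0ℓ} {P Q a b} → Family S P a → Family T Q b →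
    Family (S ×ₛ T) (λ xy → P (proj₁ xy) × Q (proj₂ xy)) (a *ℕ b)
  _×-family_ {S} {T} {P} {Q} {a} {b} (family d Pd d-inj) (family d′ Pd′ d′-inj) = family pair Ppair pair-inj
    where
    pair : Fin (a *ℕ b) → Setoid.Carrier (S ×ₛ T)
    pair c = d (proj₁ (remQuot {a} b c)) , d′ (proj₂ (remQuot {a} b c))

    Ppair : ∀ c → P (proj₁ (pair c)) × Q (proj₂ (pair c))
    Ppair c = Pd (proj₁ (remQuot {a} b c)) , Pd′ (proj₂ (remQuot {a} b c))

    pair-inj : ∀ c c′ → Setoid._≈_ (S ×ₛ T) (pair c) (pair c′) → c ≡ c′
    pair-inj c c′ (e , e′) = begin
      c                             ≡⟨ combine-remQuot {a} b c ⟨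
      combine (proj₁ rq) (proj₂ rq)   ≡⟨ ≡.cong₂ combine (d-inj _ _ e) (d′-inj _ _ e′) ⟩
      combine (proj₁ rq′) (proj₂ rq′) ≡⟨ combine-remQuot {a} b c′ ⟩
      c′                            ∎
      where
      open ≡.≡-Reasoning
      rq = remQuot {a} b c
      rq′ = remQuot {a} b c′

  Indices : ∀ {m} → (Fin m → Set) → ℕ → Set
  Indices {m} Q k = Family (≡.setoid (Fin m)) Q k

  shift : ∀ {m} {R : Fin (suc m) → Set} {k} → Indices (R ∘ suc) k → Indices R k
  shift (family e Re e-inj) = family (suc ∘ e) Re λ i j h → e-inj i j (suc-injective h)

  extend : ∀ {m} {R : Fin (suc m) → Set} {k} → R zero → Indices (R ∘ suc) k → Indices R (suc k)
  extend {R = R} R0 (family e Re e-inj) = family e′ Re′ e′-inj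
    where
    e′ : Fin _ → Fin _
    e′ zero = zero
    e′ (suc i) = suc (e i)
    Re′ : ∀ i → R (e′ i)
    Re′ zero = R0
    Re′ (suc i) = Re i
    e′-inj : ∀ i j → e′ i ≡ e′ j → i ≡ j
    e′-inj zero zero _ = ≡.refl
    e′-inj zero (suc j) ()
    e′-inj (suc i) zero ()
    e′-inj (suc i) (suc j) h = ≡.cong suc (e-inj i j (suc-injective h))

  splitIndices : ∀ m (Q : Fin m → Set) → (∀ i → Dec (Q i)) →
    Σ ℕ λ k → Σ ℕ λ k′ → (k +ℕ k′ ≡ m) × Indices (¬_ ∘ Q) k × Indices Q k′
  splitIndices zero Q Q? = 0 , 0 , ≡.refl , family (λ ()) (λ ()) (λ ()) , family (λ ()) (λ ()) (λ ())
  splitIndices (suc m) Q Q? with splitIndices m (Q ∘ suc) (Q? ∘ suc) | Q? zero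
  ... | k , k′ , k+k′≡m , fail , pass | yes Q0 =
    k , suc k′ , ≡.trans (+-suc k k′) (≡.cong suc k+k′≡m) , shift fail , extend Q0 pass
  ... | k , k′ , k+k′≡m , fail , pass | no ¬Q0 =
    suc k , k′ , ≡.cong suc k+k′≡m , extend ¬Q0 fail , shift pass

  partition : ∀ {S : Setoid 0ℓ 0ℓ} {P m} → Family S P m →
    (R : Setoid.Carrier S → Set) → (∀ a → Dec (R a)) →
    Σ ℕ λ k → Σ ℕ λ k′ → (k +ℕ k′ ≡ m) ×
      Family S (λ a → P a × ¬ R a) k × Family S (λ a → P a × R a) k′
  partition {S} {P} (family d Pd d-inj) R R? with splitIndices _ (R ∘ d) (R? ∘ d)
  ... | k , k′ , k+k′≡m , fail , pass =
    k , k′ , k+k′≡m , restrict (¬_ ∘ R) fail , restrict R pass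
    where
    restrict : ∀ (R′ : Setoid.Carrier S → Set) {k} →
      Indices (R′ ∘ d) k → Family S (λ a → P a × R′ a) k
    restrict R′ = map-family d (λ i R′i → Pd i , R′i) (λ i j _ _ → d-inj i j)

module FunctionCodes where

  funToFin-injective : ∀ {m n} {f g : Fin n → Fin m} → funToFin f ≡ funToFin g → ∀ i → f i ≡ g i
  funToFin-injective {f = f} {g} e i =
    ≡.trans (≡.sym (finToFun-funToFin f i)) (≡.trans (≡.cong (λ c → finToFun c i) e) (finToFun-funToFin g i))

  funToFin-cong : ∀ {m n} {f g : Fin n → Fin m} → (∀ i → f i ≡ g i) → funToFin f ≡ funToFin g
  funToFin-cong {n = zero} _ = ≡.refl
  funToFin-cong {n = suc n} e = ≡.cong₂ combine (e zero) (funToFin-cong (e ∘ suc))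

  finToFun-injective : ∀ {m n} {c c′ : Fin (m ^ n)} →
    (∀ i → finToFun {m} {n} c i ≡ finToFun c′ i) → c ≡ c′
  finToFun-injective {m} {n} {c} {c′} e =
    ≡.trans (≡.sym (funToFin-finToFin {n} {m} c))
      (≡.trans (funToFin-cong e) (funToFin-finToFin {n} {m} c′))

module Arithmetic where
  open import Data.Nat.Properties
    using (+-identityʳ; +-comm; ≤-trans; ≤-reflexive; +-cancelʳ-≤; *-suc; ^-*-assoc; ^-distribˡ-+-*)
  open import Data.Nat.Tactic.RingSolver using (solve-∀)

  half-units : ∀ {u z q} → u +ℕ z ≡ q → z ≤ℕ 1 → 2 ≤ℕ q → q ≤ℕ 2 *ℕ u
  half-units {u} ≡.refl z≤n _ = +-monoʳ-≤ u z≤n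
  half-units {u} ≡.refl (s≤s z≤n) q≥2 =
    +-monoʳ-≤ u (≤-trans u≥1 (≤-reflexive (≡.sym (+-identityʳ u))))
    where
    u≥1 : 1 ≤ℕ u
    u≥1 with s≤s u≥1′ ← ≤-trans q≥2 (≤-reflexive (+-comm u 1)) = u≥1′

  -- (n + 1)² - 1;  note that suc n * suc n ∸ 1 reduces to it.
  square-1 : ℕ → ℕ
  square-1 n = n +ℕ n *ℕ suc n

  ^-square-1 : ∀ q n → q ^ square-1 n ≡ q ^ n *ℕ (q ^ n *ℕ q ^ (n *ℕ n))
  ^-square-1 q n = begin
    q ^ (n +ℕ n *ℕ suc n)              ≡⟨ ^-distribˡ-+-* q n (n *ℕ suc n) ⟩
    q ^ n *ℕ q ^ (n *ℕ suc n)          ≡⟨ ≡.cong (λ e → q ^ n *ℕ q ^ e) (*-suc n n) ⟩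
    q ^ n *ℕ q ^ (n +ℕ n *ℕ n)         ≡⟨ ≡.cong (q ^ n *ℕ_) (^-distribˡ-+-* q n (n *ℕ n)) ⟩
    q ^ n *ℕ (q ^ n *ℕ q ^ (n *ℕ n))   ∎
    where open ≡.≡-Reasoning

  ^-sBound : ∀ q n → (q ^ suc (suc n)) ^ n ≡ q ^ square-1 n
  ^-sBound q n = ≡.trans (^-*-assoc q (suc (suc n)) n) (≡.cong (q ^_) (exponents n))
    where
    exponents : ∀ n → suc (suc n) *ℕ n ≡ n +ℕ n *ℕ suc n
    exponents = solve-∀

  -- The field size beyond which the lower bound for S is proved by counting,
  -- and the resulting constant in  q^(r²-1) ≤ K n #S.
  threshold : ℕ → ℕ
  threshold n = 2 ^ suc n *ℕ n

  K : ℕ → ℕ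
  K n = 2 ^ suc n +ℕ threshold n ^ square-1 n

  halve : ∀ {x a b} → x +ℕ x ≤ℕ a +ℕ b → b ≤ℕ x → x ≤ℕ a
  halve {x} {a} x+x≤a+b b≤x = +-cancelʳ-≤ x x a (≤-trans x+x≤a+b (+-monoʳ-≤ a b≤x))

module FieldFacts (F : Field) where
  open Field F hiding (zero)
  open import Algebra.Properties.AbelianGroup +-abelianGroup
    using (∙-cancelˡ; inverseʳ-unique; ⁻¹-involutive)
  open import Relation.Binary.Reasoning.Setoid setoid

  +-cancel : ∀ {x x′ y y′} → x ≈ x′ → x + y ≈ x′ + y′ → y ≈ y′
  +-cancel {x} {x′} {y} {y′} x≈x′ e = ∙-cancelˡ x y y′ (trans e (+-congʳ (sym x≈x′)))

  *-cancel-nonzero : ∀ {a x y} → ¬ a ≈ 0# → x * a ≈ y * a → x ≈ y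
  *-cancel-nonzero {a} {x} {y} a≉0 xa≈ya with inverse a a≉0
  ... | a⁻¹ , aa⁻¹≈1 = begin
    x               ≈⟨ *-identityʳ x ⟨
    x * 1#          ≈⟨ *-congˡ aa⁻¹≈1 ⟨
    x * (a * a⁻¹)   ≈⟨ *-assoc x a a⁻¹ ⟨
    x * a * a⁻¹     ≈⟨ *-congʳ xa≈ya ⟩
    y * a * a⁻¹     ≈⟨ *-assoc y a a⁻¹ ⟩
    y * (a * a⁻¹)   ≈⟨ *-congˡ aa⁻¹≈1 ⟩
    y * 1#          ≈⟨ *-identityʳ y ⟩
    y               ∎

  -x+y≈0⇒y≈x : ∀ {x y} → - x * 1# + y ≈ 0# → y ≈ x
  -x+y≈0⇒y≈x {x} {y} e =
    trans (inverseʳ-unique _ y e) (trans (-‿cong (*-identityʳ (- x))) (⁻¹-involutive x))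

module Matrices (F : Field) where
  open Field F hiding (zero)
  open MatrixDefs F
  open import Algebra.Properties.Semiring.Sum semiring
    using (sum; sum-cong-≋; sum-replicate-zero; sum-remove; ∑-comm;
           *-distribˡ-sum; *-distribʳ-sum)
  open import Data.Vec.Functional.Relation.Binary.Equality.Setoid setoid
    using (≋-setoid)
  open import Algebra.Properties.CommutativeSemigroup *-commutativeSemigroup
    using (x∙yz≈y∙xz)
  open import Relation.Binary.Reasoning.Setoid setoid

  vectorSetoid : ℕ → Setoid 0ℓ 0ℓ
  vectorSetoid = ≋-setoid

  matrixSetoid : ℕ → Setoid 0ℓ 0ℓ
  matrixSetoid n = VecOfVec.≋-setoid n
    where module VecOfVec = Data.Vec.Functional.Relation.Binary.Equality.Setoid (vectorSetoid n)

  module _ {n : ℕ} where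
    open Setoid (matrixSetoid n) public
      using () renaming (refl to ≈ₘ-refl; sym to ≈ₘ-sym; trans to ≈ₘ-trans)
    open Setoid (vectorSetoid n) public
      using () renaming (refl to ≈ᵥ-refl; sym to ≈ᵥ-sym; trans to ≈ᵥ-trans)

  ∑≡sum : ∀ n (f : Vector n) → ∑ n f ≡ sum f
  ∑≡sum zero f = ≡.refl
  ∑≡sum (suc n) f = ≡.cong (f zero +_) (∑≡sum n (f ∘ suc))

  ∑-cong : ∀ n {f g : Vector n} → f ≈ᵥ g → ∑ n f ≈ ∑ n g
  ∑-cong n {f} {g} f≈g = begin
    ∑ n f  ≡⟨ ∑≡sum _ f ⟩
    sum f  ≈⟨ sum-cong-≋ f≈g ⟩
    sum g  ≡⟨ ∑≡sum n g ⟨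
    ∑ n g  ∎

  ∑-zero : ∀ n {f : Vector n} → f ≈ᵥ zeroVec → ∑ n f ≈ 0#
  ∑-zero n f≈0 = trans (∑-cong n f≈0) (trans (reflexive (∑≡sum n zeroVec)) (sum-replicate-zero n))

  ∑-*ˡ : ∀ {n} c (f : Vector n) → c * ∑ n f ≈ ∑ n (λ i → c * f i)
  ∑-*ˡ c f = begin
    c * ∑ _ f            ≡⟨ ≡.cong (c *_) (∑≡sum _ f) ⟩
    c * sum f            ≈⟨ *-distribˡ-sum c f ⟩
    sum (λ i → c * f i)  ≡⟨ ∑≡sum _ (λ i → c * f i) ⟨
    ∑ _ (λ i → c * f i)  ∎

  ∑-*ʳ : ∀ {n} c (f : Vector n) → ∑ n f * c ≈ ∑ n (λ i → f i * c)
  ∑-*ʳ c f = begin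
    ∑ _ f * c            ≡⟨ ≡.cong (_* c) (∑≡sum _ f) ⟩
    sum f * c            ≈⟨ *-distribʳ-sum c f ⟩
    sum (λ i → f i * c)  ≡⟨ ∑≡sum _ (λ i → f i * c) ⟨
    ∑ _ (λ i → f i * c)  ∎

  ∑-swap : ∀ {m n} (f : Fin m → Fin n → Carrier) →
    ∑ m (λ i → ∑ n (f i)) ≈ ∑ n (λ j → ∑ m (λ i → f i j))
  ∑-swap {m} {n} f = begin
    ∑ m (λ i → ∑ n (f i))
      ≡⟨ ∑≡sum m (λ i → ∑ n (f i)) ⟩
    sum (λ i → ∑ n (f i))
      ≈⟨ sum-cong-≋ (λ i → reflexive (∑≡sum n (f i))) ⟩
    sum (λ i → sum (f i))
      ≈⟨ ∑-comm f ⟩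
    sum (λ j → sum (λ i → f i j))
      ≈⟨ sum-cong-≋ (λ j → reflexive (≡.sym (∑≡sum m (λ i → f i j)))) ⟩
    sum (λ j → ∑ m (λ i → f i j))
      ≡⟨ ∑≡sum n (λ j → ∑ m (λ i → f i j)) ⟨
    ∑ n (λ j → ∑ m (λ i → f i j)) ∎

  ∑-remove : ∀ {n} j (f : Vector (suc n)) → ∑ (suc n) f ≈ f j + ∑ n (f ∘ punchIn j)
  ∑-remove {n} j f = begin
    ∑ _ f                        ≡⟨ ∑≡sum _ f ⟩
    sum f                        ≈⟨ sum-remove {i = j} f ⟩
    f j + sum (f ∘ punchIn j)    ≡⟨ ≡.cong (f j +_) (∑≡sum n (f ∘ punchIn j)) ⟨
    f j + ∑ _ (f ∘ punchIn j)    ∎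

  ∑-single : ∀ {n} j (f : Vector (suc n)) → (∀ k → f (punchIn j k) ≈ 0#) → ∑ (suc n) f ≈ f j
  ∑-single j f off = trans (∑-remove j f) (trans (+-congˡ (∑-zero _ off)) (+-identityʳ (f j)))

  identity-diag : ∀ {n} (i : Fin n) → identity i i ≈ 1#
  identity-diag i with i Fin.≟ i
  ... | yes _ = refl
  ... | no i≢i = ⊥-elim (i≢i ≡.refl)

  identity-off : ∀ {n} (i j : Fin n) → ¬ i ≡ j → identity i j ≈ 0#
  identity-off i j i≢j with i Fin.≟ j
  ... | yes i≡j = ⊥-elim (i≢j i≡j)
  ... | no _ = refl

  ∑-δʳ : ∀ {n} (f : Vector n) j → ∑ n (λ k → f k * identity k j) ≈ f j
  ∑-δʳ {suc n} f j = begin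
    ∑ (suc n) (λ k → f k * identity k j)  ≈⟨ ∑-single j (λ k → f k * identity k j) off ⟩
    f j * identity j j                    ≈⟨ *-congˡ (identity-diag j) ⟩
    f j * 1#                              ≈⟨ *-identityʳ (f j) ⟩
    f j                                   ∎
    where
    off : ∀ k → f (punchIn j k) * identity (punchIn j k) j ≈ 0#
    off k = trans (*-congˡ (identity-off _ j (punchInᵢ≢i j k))) (zeroʳ _)

  ∑-δˡ : ∀ {n} (f : Vector n) i → ∑ n (λ k → identity i k * f k) ≈ f i
  ∑-δˡ {suc n} f i = begin
    ∑ (suc n) (λ k → identity i k * f k)  ≈⟨ ∑-single i (λ k → identity i k * f k) off ⟩
    identity i i * f i                    ≈⟨ *-congʳ (identity-diag i) ⟩
    1# * f i                              ≈⟨ *-identityˡ (f i) ⟩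
    f i                                   ∎
    where
    off : ∀ k → identity i (punchIn i k) * f (punchIn i k) ≈ 0#
    off k = trans (*-congʳ (identity-off i _ (punchInᵢ≢i i k ∘ ≡.sym))) (zeroˡ _)

  row-assoc : ∀ {n} (a : Vector n) (B : Matrix n) (c : Vector n) →
    ∑ n (λ k → ∑ n (λ l → a l * B l k) * c k) ≈ ∑ n (λ l → a l * ∑ n (λ k → B l k * c k))
  row-assoc {n} a B c = begin
    ∑ n (λ k → ∑ n (λ l → a l * B l k) * c k)    ≈⟨ ∑-cong n (λ k → ∑-*ʳ (c k) (λ l → a l * B l k)) ⟩
    ∑ n (λ k → ∑ n (λ l → a l * B l k * c k))    ≈⟨ ∑-swap (λ k l → a l * B l k * c k) ⟩
    ∑ n (λ l → ∑ n (λ k → a l * B l k * c k))    ≈⟨ ∑-cong n (λ l → ∑-cong n (λ k → *-assoc (a l) _ _)) ⟩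
    ∑ n (λ l → ∑ n (λ k → a l * (B l k * c k)))  ≈⟨ ∑-cong n (λ l → ∑-*ˡ (a l) (λ k → B l k * c k)) ⟨
    ∑ n (λ l → a l * ∑ n (λ k → B l k * c k))    ∎

  ·-assoc : ∀ {n} (A B C : Matrix n) → ((A · B) · C) ≈ₘ (A · (B · C))
  ·-assoc A B C i j = row-assoc (A i) B (λ k → C k j)

  ⊙-assoc : ∀ {n} (A B : Matrix n) (v : Vector n) → ((A · B) ⊙ v) ≈ᵥ (A ⊙ (B ⊙ v))
  ⊙-assoc A B v i = row-assoc (A i) B v

  ·-identityˡ : ∀ {n} (A : Matrix n) → (identity · A) ≈ₘ A
  ·-identityˡ A i j = ∑-δˡ (λ k → A k j) i

  ·-identityʳ : ∀ {n} (A : Matrix n) → (A · identity) ≈ₘ A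
  ·-identityʳ A i j = ∑-δʳ (A i) j

  ⊙-identity : ∀ {n} (v : Vector n) → (identity ⊙ v) ≈ᵥ v
  ⊙-identity v i = ∑-δˡ v i

  ·-cong : ∀ {n} {A A′ B B′ : Matrix n} → A ≈ₘ A′ → B ≈ₘ B′ → (A · B) ≈ₘ (A′ · B′)
  ·-cong {n} A≈A′ B≈B′ i j = ∑-cong n (λ k → *-cong (A≈A′ i k) (B≈B′ k j))

  ⊙-cong : ∀ {n} {A A′ : Matrix n} {v v′ : Vector n} → A ≈ₘ A′ → v ≈ᵥ v′ → (A ⊙ v) ≈ᵥ (A′ ⊙ v′)
  ⊙-cong {n} A≈A′ v≈v′ i = ∑-cong n (λ k → *-cong (A≈A′ i k) (v≈v′ k))

  ·-congˡ : ∀ {n} (A : Matrix n) {B B′} → B ≈ₘ B′ → (A · B) ≈ₘ (A · B′)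
  ·-congˡ A = ·-cong {A = A} ≈ₘ-refl

  ·-congʳ : ∀ {n} (B : Matrix n) {A A′} → A ≈ₘ A′ → (A · B) ≈ₘ (A′ · B)
  ·-congʳ B A≈A′ = ·-cong A≈A′ (≈ₘ-refl {x = B})

  ⊙-congˡ : ∀ {n} (A : Matrix n) {v v′ : Vector n} → v ≈ᵥ v′ → (A ⊙ v) ≈ᵥ (A ⊙ v′)
  ⊙-congˡ A = ⊙-cong {A = A} ≈ₘ-refl

  ⊙-congʳ : ∀ {n} (v : Vector n) {A A′ : Matrix n} → A ≈ₘ A′ → (A ⊙ v) ≈ᵥ (A′ ⊙ v)
  ⊙-congʳ v A≈A′ = ⊙-cong A≈A′ (≈ᵥ-refl {x = v})

  ⊙-scale : ∀ {n} (A : Matrix n) c (v : Vector n) → (A ⊙ (λ k → c * v k)) ≈ᵥ (λ i → c * (A ⊙ v) i)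
  ⊙-scale {n} A c v i = begin
    ∑ n (λ k → A i k * (c * v k))  ≈⟨ ∑-cong n (λ k → x∙yz≈y∙xz (A i k) c (v k)) ⟩
    ∑ n (λ k → c * (A i k * v k))  ≈⟨ ∑-*ˡ c (λ k → A i k * v k) ⟨
    c * ∑ n (λ k → A i k * v k)    ∎

  cancelˡ : ∀ {n} (A′ A : Matrix n) → (A′ · A) ≈ₘ identity → ∀ B → (A′ · (A · B)) ≈ₘ B
  cancelˡ A′ A A′A≈I B =
    ≈ₘ-trans (≈ₘ-sym (·-assoc A′ A B)) (≈ₘ-trans (·-cong A′A≈I ≈ₘ-refl) (·-identityˡ B))

  cancelʳ : ∀ {n} (A A′ : Matrix n) → (A · A′) ≈ₘ identity → ∀ B → ((B · A) · A′) ≈ₘ B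
  cancelʳ A A′ AA′≈I B =
    ≈ₘ-trans (·-assoc B A A′) (≈ₘ-trans (·-cong ≈ₘ-refl AA′≈I) (·-identityʳ B))

  ⊙-cancelˡ : ∀ {n} (A′ A : Matrix n) → (A′ · A) ≈ₘ identity → ∀ v → (A′ ⊙ (A ⊙ v)) ≈ᵥ v
  ⊙-cancelˡ A′ A A′A≈I v =
    ≈ᵥ-trans (≈ᵥ-sym (⊙-assoc A′ A v)) (≈ᵥ-trans (⊙-cong A′A≈I ≈ᵥ-refl) (⊙-identity v))

  GL-identity : ∀ {n} → InGL (identity {n})
  GL-identity = identity , ·-identityˡ identity , ·-identityˡ identity

  GL-· : ∀ {n} {A B : Matrix n} → InGL A → InGL B → InGL (A · B)
  GL-· {A = A} {B} (A⁻¹ , AA⁻¹ , A⁻¹A) (B⁻¹ , BB⁻¹ , B⁻¹B) =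
    B⁻¹ · A⁻¹ ,
    ≈ₘ-trans (·-assoc A B (B⁻¹ · A⁻¹)) (≈ₘ-trans (·-cong ≈ₘ-refl (cancelˡ B B⁻¹ BB⁻¹ A⁻¹)) AA⁻¹) ,
    ≈ₘ-trans (·-assoc B⁻¹ A⁻¹ (A · B)) (≈ₘ-trans (·-cong ≈ₘ-refl (cancelˡ A⁻¹ A A⁻¹A B)) B⁻¹B)

module BlockMatrices (F : Field) where
  open Field F hiding (zero)
  open MatrixDefs F
  open Matrices F
  open import Algebra.Properties.Ring ring using (-1*x≈-x; -‿distribˡ-*; -‿distribʳ-*)
  open import Relation.Binary.Reasoning.Setoid setoid

  -- Block matrices of size 1 + n,  ( a  uᵀ )
  --                                ( w  B  ).
  -- By the definition of ∑, their products are computed blockwise.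
  block : ∀ {n} → Carrier → Vector n → Vector n → Matrix n → Matrix (suc n)
  block a u w B = (a ∷ u) ∷ λ i → w i ∷ B i

  shear : ∀ {n} → Vector n → Matrix (suc n)
  shear w = block 1# zeroVec w identity

  upper : ∀ {n} → Carrier → Vector n → Matrix n → Matrix (suc n)
  upper a u B = block a u zeroVec B

  identity-suc : ∀ {n} (i j : Fin n) → identity {suc n} (suc i) (suc j) ≡ identity i j
  identity-suc i j with i Fin.≟ j
  ... | yes _ = ≡.refl
  ... | no _ = ≡.refl

  identity-lower-right : ∀ {n} {c x} (i j : Fin n) → c ≈ 0# → x ≈ identity i j →
    c + x ≈ identity {suc n} (suc i) (suc j)
  identity-lower-right i j c≈0 x≈δ =
    trans (+-cong c≈0 x≈δ) (trans (+-identityˡ _) (reflexive (≡.sym (identity-suc i j))))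

  shear-inverse : ∀ {n} (w w′ : Vector n) → (∀ i → w i + w′ i ≈ 0#) → (shear w · shear w′) ≈ₘ identity
  shear-inverse {n} w w′ w+w′≈0 zero zero = trans (+-cong (*-identityˡ 1#) (∑-zero n (λ k → zeroˡ _))) (+-identityʳ 1#)
  shear-inverse {n} w w′ w+w′≈0 zero (suc j) = trans (+-cong (zeroʳ 1#) (∑-zero n (λ k → zeroˡ _))) (+-identityʳ 0#)
  shear-inverse w w′ w+w′≈0 (suc i) zero = trans (+-cong (*-identityʳ (w i)) (∑-δˡ w′ i)) (w+w′≈0 i)
  shear-inverse w w′ w+w′≈0 (suc i) (suc j) =
    identity-lower-right i j (zeroʳ (w i)) (·-identityˡ identity i j)

  shear-GL : ∀ {n} (w : Vector n) → InGL (shear w)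
  shear-GL w = shear (λ i → - w i) ,
    shear-inverse w (λ i → - w i) (λ i → -‿inverseʳ (w i)) ,
    shear-inverse (λ i → - w i) w (λ i → -‿inverseˡ (w i))

  upper-inverse : ∀ {n} {a a′} {u u′ : Vector n} {B B′ : Matrix n} →
    a * a′ ≈ 1# → (B · B′) ≈ₘ identity →
    (∀ j → a * u′ j + ∑ n (λ k → u k * B′ k j) ≈ 0#) →
    (upper a u B · upper a′ u′ B′) ≈ₘ identity
  upper-inverse {n} aa′≈1 _ _ zero zero = trans (+-cong aa′≈1 (∑-zero n (λ k → zeroʳ _))) (+-identityʳ 1#)
  upper-inverse _ _ top≈0 zero (suc j) = top≈0 j
  upper-inverse {n} _ _ _ (suc i) zero = trans (+-cong (zeroˡ _) (∑-zero n (λ k → zeroʳ _))) (+-identityʳ 0#)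
  upper-inverse _ BB′≈I _ (suc i) (suc j) = identity-lower-right i j (zeroˡ _) (BB′≈I i j)

  -- With a a′ = 1 and B B′ ≈ I ≈ B′ B, the inverse of ( a uᵀ ; 0 B ) is
  -- ( a′ -a′uᵀB′ ; 0 B′ ).
  upper-GL : ∀ {n} {a a′} (u : Vector n) (B : Matrix n) → a * a′ ≈ 1# → InGL B → InGL (upper a u B)
  upper-GL {n} {a} {a′} u B aa′≈1 (B′ , BB′≈I , B′B≈I) =
    upper a′ u′ B′ ,
    upper-inverse aa′≈1 BB′≈I right ,
    upper-inverse (trans (*-comm a′ a) aa′≈1) B′B≈I left
    where
    uB′ : Vector n
    uB′ j = ∑ n (λ k → u k * B′ k j)

    u′ : Vector n
    u′ j = - a′ * uB′ j

    right : ∀ j → a * u′ j + uB′ j ≈ 0#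
    right j = begin
      a * (- a′ * uB′ j) + uB′ j  ≈⟨ +-congʳ (*-assoc a (- a′) (uB′ j)) ⟨
      a * - a′ * uB′ j + uB′ j    ≈⟨ +-congʳ (*-congʳ (trans (sym (-‿distribʳ-* a a′)) (-‿cong aa′≈1))) ⟩
      - 1# * uB′ j + uB′ j        ≈⟨ +-congʳ (-1*x≈-x (uB′ j)) ⟩
      - uB′ j + uB′ j             ≈⟨ -‿inverseˡ (uB′ j) ⟩
      0#                          ∎

    left : ∀ j → a′ * u j + ∑ n (λ k → u′ k * B k j) ≈ 0#
    left j = begin
      a′ * u j + ∑ n (λ k → - a′ * uB′ k * B k j)
        ≈⟨ +-congˡ (∑-cong n (λ k → *-assoc (- a′) (uB′ k) (B k j))) ⟩
      a′ * u j + ∑ n (λ k → - a′ * (uB′ k * B k j))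
        ≈⟨ +-congˡ (∑-*ˡ (- a′) (λ k → uB′ k * B k j)) ⟨
      a′ * u j + - a′ * ∑ n (λ k → uB′ k * B k j)
        ≈⟨ +-congˡ (*-congˡ (row-assoc u B′ (λ k → B k j))) ⟩
      a′ * u j + - a′ * ∑ n (λ l → u l * (B′ · B) l j)
        ≈⟨ +-congˡ (*-congˡ (∑-cong n (λ l → *-congˡ (B′B≈I l j)))) ⟩
      a′ * u j + - a′ * ∑ n (λ l → u l * identity l j)
        ≈⟨ +-congˡ (*-congˡ (∑-δʳ u j)) ⟩
      a′ * u j + - a′ * u j
        ≈⟨ +-congˡ (-‿distribˡ-* a′ (u j)) ⟨
      a′ * u j + - (a′ * u j)
        ≈⟨ -‿inverseʳ (a′ * u j) ⟩
      0# ∎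

  shear·upper : ∀ {n} (w : Vector n) a u (B : Matrix n) →
    (shear w · upper a u B) ≈ₘ block a u (λ i → w i * a) (λ i j → w i * u j + B i j)
  shear·upper {n} w a u B zero zero =
    trans (+-cong (*-identityˡ a) (∑-zero n (λ k → zeroˡ _))) (+-identityʳ a)
  shear·upper {n} w a u B zero (suc j) =
    trans (+-cong (*-identityˡ (u j)) (∑-zero n (λ k → zeroˡ _))) (+-identityʳ (u j))
  shear·upper {n} w a u B (suc i) zero =
    trans (+-congˡ (∑-zero n (λ k → zeroʳ _))) (+-identityʳ _)
  shear·upper w a u B (suc i) (suc j) = +-congˡ (·-identityˡ B i j)

  shear-⊙ : ∀ {n} (w : Vector n) t y → (shear w ⊙ (t ∷ y)) ≈ᵥ (t ∷ λ i → w i * t + y i)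
  shear-⊙ {n} w t y zero = trans (+-cong (*-identityˡ t) (∑-zero n (λ k → zeroˡ _))) (+-identityʳ t)
  shear-⊙ w t y (suc i) = +-congˡ (⊙-identity y i)

  upper-⊙ : ∀ {n} a (u : Vector n) (B : Matrix n) t y →
    (upper a u B ⊙ (t ∷ y)) ≈ᵥ ((a * t + ∑ n (λ k → u k * y k)) ∷ (B ⊙ y))
  upper-⊙ a u B t y zero = refl
  upper-⊙ a u B t y (suc i) = trans (+-congʳ (zeroˡ t)) (+-identityˡ _)

  shear-cong : ∀ {n} {w w′ : Vector n} → w ≈ᵥ w′ → shear w ≈ₘ shear w′
  shear-cong w≈w′ zero j = refl
  shear-cong w≈w′ (suc i) zero = w≈w′ i
  shear-cong w≈w′ (suc i) (suc j) = refl

module FiniteField (F : Field) {q : ℕ} (size : FieldOfSize F q) where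
  open Field F hiding (zero)
  open MatrixDefs F
  open Matrices F
  open FunctionCodes
  open Counting
  open Arithmetic

  element : Fin q → Carrier
  element = proj₁ size

  element-injective : ∀ i j → element i ≈ element j → i ≡ j
  element-injective = proj₁ (proj₂ (proj₂ size))

  index : Carrier → Fin q
  index a = proj₁ (proj₂ (proj₂ (proj₂ size)) a tt)

  element-index : ∀ a → a ≈ element (index a)
  element-index a = proj₂ (proj₂ (proj₂ (proj₂ size)) a tt)

  index-injective : ∀ {a b} → index a ≡ index b → a ≈ b
  index-injective {a} {b} e =
    trans (element-index a) (trans (reflexive (≡.cong element e)) (sym (element-index b)))

  index-cong : ∀ {a b} → a ≈ b → index a ≡ index b
  index-cong {a} {b} a≈b = element-injective _ _ (trans (sym (element-index a)) (trans a≈b (element-index b)))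

  _≟_ : ∀ a b → Dec (a ≈ b)
  a ≟ b with index a Fin.≟ index b
  ... | yes e = yes (index-injective e)
  ... | no ne = no (ne ∘ index-cong)

  _≟ᵥ_ : ∀ {n} (u v : Vector n) → Dec (u ≈ᵥ v)
  u ≟ᵥ v = all? (λ i → u i ≟ v i)

  vcode : ∀ {n} → Vector n → Fin (q ^ n)
  vcode v = funToFin (index ∘ v)

  vcode-injective : ∀ {n} {u v : Vector n} → vcode u ≡ vcode v → u ≈ᵥ v
  vcode-injective e i = index-injective (funToFin-injective e i)

  vdecode : ∀ {n} → Fin (q ^ n) → Vector n
  vdecode c = element ∘ finToFun c

  vdecode-vcode : ∀ {n} (v : Vector n) → v ≈ᵥ vdecode (vcode v)
  vdecode-vcode v i =
    trans (element-index (v i)) (reflexive (≡.cong element (≡.sym (finToFun-funToFin (index ∘ v) i))))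

  vectors : ∀ {n} → Family (vectorSetoid n) (λ _ → ⊤) (q ^ n)
  vectors = family vdecode (λ _ → tt) λ c c′ e → finToFun-injective (λ i → element-injective _ _ (e i))

  search : ∀ {n} (Q : Vector n → Set) → (∀ {u v} → u ≈ᵥ v → Q u → Q v) →
    (∀ v → Dec (Q v)) → Dec (∃ Q)
  search Q Q-resp Q? with any? (Q? ∘ vdecode)
  ... | yes (c , Qc) = yes (vdecode c , Qc)
  ... | no none = no λ (v , Qv) → none (vcode v , Q-resp (vdecode-vcode v) Qv)

  matrixCoding : ∀ {n} (P : Matrix n → Set) → Coding (matrixSetoid n) P ((q ^ n) ^ n)
  matrixCoding P = coding (λ A _ → funToFin (vcode ∘ A))
    λ A B _ _ e i → vcode-injective (funToFin-injective e i)

  elements : Family setoid (λ _ → ⊤) q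
  elements = family element (λ _ → tt) element-injective

  q≥2 : 2 ≤ℕ q
  q≥2 = family≤card zero-one size
    where
    zero-one : Family setoid (λ _ → ⊤) 2
    zero-one = family (λ { zero → 0# ; (suc zero) → 1# }) (λ _ → tt)
      λ { zero zero _ → ≡.refl ; zero (suc zero) 0≈1 → ⊥-elim (0≉1 0≈1)
        ; (suc zero) zero 1≈0 → ⊥-elim (0≉1 (sym 1≈0)) ; (suc zero) (suc zero) _ → ≡.refl }

  units : Σ ℕ λ u → (q ≤ℕ 2 *ℕ u) × Family setoid (λ a → ¬ a ≈ 0#) u
  units with partition elements (_≈ 0#) (_≟ 0#)
  ... | u , z , u+z≡q , nonzero , zeros = u , q≤2u , weaken proj₂ nonzero
    where
    z≤1 : z ≤ℕ 1
    z≤1 = family≤coding zeros (coding (λ _ _ → zero) λ a b a≈0 b≈0 _ → trans (proj₂ a≈0) (sym (proj₂ b≈0)))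

    q≤2u : q ≤ℕ 2 *ℕ u
    q≤2u = half-units u+z≡q z≤1 q≥2

-- A fixed vector may be scaled to
-- have a coordinate j equal to 1; then column j of g is determined by the
-- other columns and coordinates, so g is determined by j together with n
-- vectors of length n + 2:  #S ≤ (n + 1) q^((n+2) n) = (n + 1) q^(r² - 1).
module UpperBoundS (F : Field) {q : ℕ} (size : FieldOfSize F q) where
  open Field F hiding (zero)
  open MatrixDefs F
  open Matrices F
  open FunctionCodes
  open FiniteField F size
  open Counting
  open import Algebra.Properties.AbelianGroup +-abelianGroup using (x≈z//y)
  open import Relation.Binary.Reasoning.Setoid setoid

  pivot-or-punchIn : ∀ {n} (j l : Fin (suc n)) → l ≡ j ⊎ ∃ λ k → l ≡ punchIn j k
  pivot-or-punchIn j l with l Fin.≟ j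
  ... | yes l≡j = inj₁ l≡j
  ... | no l≢j = inj₂ (punchOut (l≢j ∘ ≡.sym) , ≡.sym (punchIn-punchOut (l≢j ∘ ≡.sym)))

  record PivotedFixedVector {n} (g : Matrix (suc n)) (j : Fin (suc n)) (w : Vector (suc n)) : Set where
    constructor pivoted
    field
      pivot-one : w j ≈ 1#
      fixed : (g ⊙ w) ≈ᵥ w
  open PivotedFixedVector

  Pivoted : ∀ {n} → Matrix (suc n) → Set
  Pivoted {n} g = Σ (Fin (suc n)) λ j → Σ (Vector (suc n)) λ w → PivotedFixedVector g j w

  pivot : ∀ {n} {g : Matrix (suc n)} → InS g → Pivoted g
  pivot {n} {g} (_ , v , v≉0 , gv≈v) with ¬∀⟶∃¬ (suc n) (λ i → v i ≈ 0#) (λ i → v i ≟ 0#) v≉0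
  ... | j , vj≉0 with inverse (v j) vj≉0
  ... | c , vjc≈1 =
    j , (λ i → c * v i) ,
    pivoted (trans (*-comm c (v j)) vjc≈1) (λ i → trans (⊙-scale g c v i) (*-congˡ (gv≈v i)))

  pivot-column : ∀ {n} {g : Matrix (suc n)} {j w} → PivotedFixedVector g j w →
    ∀ i → g i j ≈ w i + - ∑ n (λ k → g i (punchIn j k) * w (punchIn j k))
  pivot-column {n} {g} {j} {w} (pivoted wj≈1 gw≈w) i = begin
    g i j        ≈⟨ *-identityʳ (g i j) ⟨
    g i j * 1#   ≈⟨ *-congˡ wj≈1 ⟨
    g i j * w j  ≈⟨ x≈z//y _ _ _ (trans (sym (∑-remove j (λ l → g i l * w l))) (gw≈w i)) ⟩
    w i + - ∑ n (λ k → g i (punchIn j k) * w (punchIn j k)) ∎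

  pivot-determines : ∀ {n} {g g′ : Matrix (suc n)} {j w w′} →
    PivotedFixedVector g j w → PivotedFixedVector g′ j w′ →
    (∀ k → w (punchIn j k) ≈ w′ (punchIn j k)) →
    (∀ i k → g i (punchIn j k) ≈ g′ i (punchIn j k)) → g ≈ₘ g′
  pivot-determines {n} {g} {g′} {j} {w} {w′} fix fix′ w≈w′ g≈g′ i l
    with pivot-or-punchIn j l
  ... | inj₂ (k , ≡.refl) = g≈g′ i k
  ... | inj₁ ≡.refl = begin
    g i j                                                   ≈⟨ pivot-column fix i ⟩
    w i + - ∑ n (λ k → g i (punchIn j k) * w (punchIn j k))
      ≈⟨ +-cong wi≈w′i (-‿cong (∑-cong n (λ k → *-cong (g≈g′ i k) (w≈w′ k)))) ⟩
    w′ i + - ∑ n (λ k → g′ i (punchIn j k) * w′ (punchIn j k)) ≈⟨ pivot-column fix′ i ⟨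
    g′ i j                                                  ∎
    where
    wi≈w′i : w i ≈ w′ i
    wi≈w′i with pivot-or-punchIn j i
    ... | inj₁ ≡.refl = trans (pivot-one fix) (sym (pivot-one fix′))
    ... | inj₂ (k , ≡.refl) = w≈w′ k

  weightedColumn : ∀ {n} → Matrix (suc n) → Fin (suc n) → Vector (suc n) → Fin n → Vector (suc (suc n))
  weightedColumn g j w k = w (punchIn j k) ∷ λ i → g i (punchIn j k)

  sBound : ℕ → ℕ
  sBound zero = 0
  sBound (suc n) = suc n *ℕ (q ^ suc (suc n)) ^ n

  sCoding : ∀ n → Coding (matrixSetoid n) InS (sBound n)
  sCoding zero = coding (λ _ (_ , v , v≉0 , _) → ⊥-elim (v≉0 λ ())) λ _ _ (_ , _ , v≉0 , _) → ⊥-elim (v≉0 λ ())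
  sCoding (suc n) =
    coding (λ g s → codeFrom g (pivot s))
    λ g g′ s s′ → codeFrom-injective (pivot s) (pivot s′)
    where
    codeFrom : ∀ (g : Matrix (suc n)) → Pivoted g → Fin (sBound (suc n))
    codeFrom g (j , w , _) = combine j (funToFin (vcode ∘ weightedColumn g j w))

    codeFrom-injective : ∀ {g g′} (p : Pivoted g) (p′ : Pivoted g′) → codeFrom g p ≡ codeFrom g′ p′ → g ≈ₘ g′
    codeFrom-injective {g} {g′} (j , w , fix) (j′ , w′ , fix′) e
      with combine-injective j (funToFin (vcode ∘ weightedColumn g j w))
                             j′ (funToFin (vcode ∘ weightedColumn g′ j′ w′)) e
    ... | ≡.refl , same-columns =
      pivot-determines fix fix′ (λ k → columns≈ k zero) (λ i k → columns≈ k (suc i))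
      where
      columns≈ : ∀ k → weightedColumn g j w k ≈ᵥ weightedColumn g′ j w′ k
      columns≈ k = vcode-injective (funToFin-injective same-columns k)

-- The products ( 1 0 ; w I ) ( a uᵀ ; 0 B ), with
-- a a unit, u, w ∈ F^n and B ∈ GL(n, F), are invertible and determine
-- (a, u, w, B); by induction GL(n, F) has at least glCount n elements.
module LowerBoundGL (F : Field) {q : ℕ} (size : FieldOfSize F q) where
  open Field F hiding (zero)
  open MatrixDefs F
  open Matrices F
  open BlockMatrices F
  open FieldFacts F
  open FiniteField F size
  open Counting

  #units : ℕ
  #units = proj₁ units

  glCount : ℕ → ℕ
  glCount zero = 1
  glCount (suc n) = #units *ℕ (q ^ n *ℕ (q ^ n *ℕ glCount n))

  Parameters : ℕ → Setoid 0ℓ 0ℓ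
  Parameters n = setoid ×ₛ (vectorSetoid n ×ₛ (vectorSetoid n ×ₛ matrixSetoid n))

  fromLU : ∀ {n} → Setoid.Carrier (Parameters n) → Matrix (suc n)
  fromLU (a , u , w , B) = shear w · upper a u B

  ValidParameters : ∀ {n} → Setoid.Carrier (Parameters n) → Set
  ValidParameters (a , u , w , B) = ¬ a ≈ 0# × (⊤ × (⊤ × InGL B))

  shear·upper-GL : ∀ {n} p → ValidParameters {n} p → InGL (fromLU p)
  shear·upper-GL (a , u , w , B) (a≉0 , _ , _ , B∈GL) =
    GL-· {A = shear w} {upper a u B} (shear-GL w) (upper-GL u B (proj₂ (inverse a a≉0)) B∈GL)

  -- The entries a, u, w a and w uᵀ + B of the product recover (a, u, w, B).
  shear·upper-reflects : ∀ {n} p p′ → ValidParameters {n} p → ValidParameters p′ →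
    fromLU p ≈ₘ fromLU p′ → Setoid._≈_ (Parameters n) p p′
  shear·upper-reflects (a , u , w , B) (a′ , u′ , w′ , B′) (a≉0 , _) _ e =
    a≈a′ , u≈u′ , w≈w′ , B≈B′
    where
    blocks : block a u (λ i → w i * a) (λ i j → w i * u j + B i j) ≈ₘ
             block a′ u′ (λ i → w′ i * a′) (λ i j → w′ i * u′ j + B′ i j)
    blocks = ≈ₘ-trans (≈ₘ-sym (shear·upper w a u B)) (≈ₘ-trans e (shear·upper w′ a′ u′ B′))

    a≈a′ : a ≈ a′
    a≈a′ = blocks zero zero

    u≈u′ : u ≈ᵥ u′
    u≈u′ j = blocks zero (suc j)

    w≈w′ : w ≈ᵥ w′
    w≈w′ i = *-cancel-nonzero a≉0 (trans (blocks (suc i) zero) (*-congˡ (sym a≈a′)))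

    B≈B′ : B ≈ₘ B′
    B≈B′ i j = +-cancel (*-cong (w≈w′ i) (u≈u′ j)) (blocks (suc i) (suc j))

  glFamily : ∀ n → Family (matrixSetoid n) InGL (glCount n)
  glFamily zero = family (λ _ ()) (λ _ → (λ ()) , (λ ()) , (λ ())) λ { zero zero _ → ≡.refl }
  glFamily (suc n) =
    map-family fromLU shear·upper-GL shear·upper-reflects
      (proj₂ (proj₂ units) ×-family (vectors ×-family (vectors ×-family glFamily n)))

-- If B ∈ GL(n, F) has no non-zero
-- fixed vector, then g = L_X ( 1 uᵀ ; 0 B ) L_X⁻¹ with the shear L_X = ( 1 0 ; X I )
-- lies in S, its fixed vectors are the multiples of (1 ; X), and g determines
-- (X, u, B).  The fixed-point-free members of the family of GL(n, F) are all but
-- at most sBound n of them, which bounds #S(GL(n+1)) from below.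
module LowerBoundS (F : Field) {q : ℕ} (size : FieldOfSize F q) where
  open Field F hiding (zero)
  open MatrixDefs F
  open Matrices F
  open BlockMatrices F
  open FieldFacts F
  open FiniteField F size
  open UpperBoundS F size using (sBound; sCoding)
  open LowerBoundGL F size using (glCount; glFamily)
  open Counting

  HasFixedVector : ∀ {n} → Matrix n → Set
  HasFixedVector {n} B = ∃ λ (v : Vector n) → ¬ (v ≈ᵥ zeroVec) × ((B ⊙ v) ≈ᵥ v)

  hasFixedVector? : ∀ {n} (B : Matrix n) → Dec (HasFixedVector B)
  hasFixedVector? B = search _ respects (λ v → ¬? (v ≟ᵥ zeroVec) ×-dec ((B ⊙ v) ≟ᵥ v))
    where
    respects : ∀ {u v} → u ≈ᵥ v → ¬ (u ≈ᵥ zeroVec) × ((B ⊙ u) ≈ᵥ u) → ¬ (v ≈ᵥ zeroVec) × ((B ⊙ v) ≈ᵥ v)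
    respects u≈v (u≉0 , Bu≈u) =
      (λ v≈0 → u≉0 (≈ᵥ-trans u≈v v≈0)) ,
      ≈ᵥ-trans (⊙-congˡ B (≈ᵥ-sym u≈v)) (≈ᵥ-trans Bu≈u u≈v)

  fixed⇒zero : ∀ {n} {B : Matrix n} → ¬ HasFixedVector B → ∀ v → (B ⊙ v) ≈ᵥ v → v ≈ᵥ zeroVec
  fixed⇒zero ¬fixed v Bv≈v with v ≟ᵥ zeroVec
  ... | yes v≈0 = v≈0
  ... | no v≉0 = ⊥-elim (¬fixed (v , v≉0 , Bv≈v))

  conjugate : ∀ {n} → Vector n → Vector n → Matrix n → Matrix (suc n)
  conjugate X u B = (shear X · upper 1# u B) · shear (λ i → - X i)

  shear-inverseˡ : ∀ {n} (X : Vector n) → (shear (λ i → - X i) · shear X) ≈ₘ identity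
  shear-inverseˡ X = shear-inverse (λ i → - X i) X (λ i → -‿inverseˡ (X i))

  conjugate-GL : ∀ {n} X u {B : Matrix n} → InGL B → InGL (conjugate X u B)
  conjugate-GL X u {B} B∈GL =
    GL-· {A = shear X · upper 1# u B} {shear (λ i → - X i)}
      (GL-· {A = shear X} {upper 1# u B} (shear-GL X) (upper-GL u B (*-identityʳ 1#) B∈GL))
      (shear-GL (λ i → - X i))

  -- (1 ; X) is a fixed vector: L_X⁻¹ (1 ; X) = e₀ = H e₀ and L_X e₀ = (1 ; X).
  conjugate-fixes : ∀ {n} (X u : Vector n) (B : Matrix n) →
    (conjugate X u B ⊙ (1# ∷ X)) ≈ᵥ (1# ∷ X)
  conjugate-fixes {n} X u B = begin
    conjugate X u B ⊙ (1# ∷ X)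
      ≈⟨ ⊙-assoc (shear X · H) (shear (λ i → - X i)) (1# ∷ X) ⟩
    (shear X · H) ⊙ (shear (λ i → - X i) ⊙ (1# ∷ X))
      ≈⟨ ⊙-congˡ (shear X · H) (≈ᵥ-trans (shear-⊙ _ 1# X) unshear) ⟩
    (shear X · H) ⊙ e₀
      ≈⟨ ⊙-assoc (shear X) H e₀ ⟩
    shear X ⊙ (H ⊙ e₀)
      ≈⟨ ⊙-congˡ (shear X) (≈ᵥ-trans (upper-⊙ 1# u B 1# zeroVec) He₀) ⟩
    shear X ⊙ e₀
      ≈⟨ ≈ᵥ-trans (shear-⊙ X 1# zeroVec) shear-e₀ ⟩
    1# ∷ X ∎
    where
    open import Relation.Binary.Reasoning.Setoid (vectorSetoid (suc n))
    H : Matrix (suc n)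
    H = upper 1# u B

    e₀ : Vector (suc n)
    e₀ = 1# ∷ zeroVec

    unshear : (1# ∷ λ i → - X i * 1# + X i) ≈ᵥ e₀
    unshear zero = refl
    unshear (suc i) = trans (+-congʳ (*-identityʳ (- X i))) (-‿inverseˡ (X i))

    He₀ : ((1# * 1# + ∑ n (λ k → u k * 0#)) ∷ (B ⊙ zeroVec)) ≈ᵥ e₀
    He₀ zero = trans (+-cong (*-identityʳ 1#) (∑-zero n (λ k → zeroʳ (u k)))) (+-identityʳ 1#)
    He₀ (suc i) = ∑-zero n (λ k → zeroʳ (B i k))

    shear-e₀ : (1# ∷ λ i → X i * 1# + 0#) ≈ᵥ (1# ∷ X)
    shear-e₀ zero = refl
    shear-e₀ (suc i) = trans (+-identityʳ _) (*-identityʳ (X i))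

  conjugate-S : ∀ {n} X u {B : Matrix n} → InGL B → InS (conjugate X u B)
  conjugate-S X u {B} B∈GL =
    conjugate-GL X u B∈GL , (1# ∷ X) , (λ v≈0 → 0≉1 (sym (v≈0 zero))) , conjugate-fixes X u B

  conjugate-fixed : ∀ {n} (X u : Vector n) (B : Matrix n) {y} → (conjugate X u B ⊙ y) ≈ᵥ y →
    (upper 1# u B ⊙ (shear (λ i → - X i) ⊙ y)) ≈ᵥ (shear (λ i → - X i) ⊙ y)
  conjugate-fixed {n} X u B {y} gy≈y = begin
    H ⊙ d                  ≈⟨ ⊙-cancelˡ L⁻¹ L (shear-inverseˡ X) (H ⊙ d) ⟨
    L⁻¹ ⊙ (L ⊙ (H ⊙ d))    ≈⟨ ⊙-congˡ L⁻¹ (⊙-assoc L H d) ⟨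
    L⁻¹ ⊙ ((L · H) ⊙ d)    ≈⟨ ⊙-congˡ L⁻¹ (≈ᵥ-trans (≈ᵥ-sym (⊙-assoc (L · H) L⁻¹ y)) gy≈y) ⟩
    L⁻¹ ⊙ y                ∎
    where
    open import Relation.Binary.Reasoning.Setoid (vectorSetoid (suc n))
    H L L⁻¹ : Matrix (suc n)
    H = upper 1# u B
    L = shear X
    L⁻¹ = shear (λ i → - X i)

    d : Vector (suc n)
    d = L⁻¹ ⊙ y

  unconjugate : ∀ {n} (X u : Vector n) (B : Matrix n) →
    ((shear (λ i → - X i) · conjugate X u B) · shear X) ≈ₘ upper 1# u B
  unconjugate {n} X u B = begin
    (L⁻¹ · ((L · H) · L⁻¹)) · L  ≈⟨ ·-congʳ L (·-assoc L⁻¹ (L · H) L⁻¹) ⟨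
    ((L⁻¹ · (L · H)) · L⁻¹) · L  ≈⟨ cancelʳ L⁻¹ L (shear-inverseˡ X) (L⁻¹ · (L · H)) ⟩
    L⁻¹ · (L · H)                ≈⟨ cancelˡ L⁻¹ L (shear-inverseˡ X) H ⟩
    H                            ∎
    where
    open import Relation.Binary.Reasoning.Setoid (matrixSetoid (suc n))
    H L L⁻¹ : Matrix (suc n)
    H = upper 1# u B
    L = shear X
    L⁻¹ = shear (λ i → - X i)

  Parameters : ℕ → Setoid 0ℓ 0ℓ
  Parameters n = vectorSetoid n ×ₛ (vectorSetoid n ×ₛ matrixSetoid n)

  conjugateOf : ∀ {n} → Setoid.Carrier (Parameters n) → Matrix (suc n)
  conjugateOf (X , u , B) = conjugate X u B

  ValidParameters : ∀ {n} → Setoid.Carrier (Parameters n) → Set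
  ValidParameters (X , u , B) = ⊤ × (⊤ × (InGL B × ¬ HasFixedVector B))

  -- For fixed-point-free B the conjugate determines (X, u, B): first the fixed
  -- vector (1 ; X′) of g′ ≈ g gives, after L_X⁻¹, a fixed vector of H whose
  -- tail X′ - X is fixed by B; then X ≈ X′ and unconjugating gives H ≈ H′.
  conjugate-reflects : ∀ {n} p p′ → ValidParameters {n} p → ValidParameters p′ →
    conjugateOf p ≈ₘ conjugateOf p′ → Setoid._≈_ (Parameters n) p p′
  conjugate-reflects {n} (X , u , B) (X′ , u′ , B′) (_ , _ , _ , ¬fixed) _ g≈g′ =
    X≈X′ , (λ j → H≈H′ zero (suc j)) , (λ i j → H≈H′ (suc i) (suc j))
    where
    -- L_X⁻¹ (1 ; X′) = (1 ; X′ - X)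
    d : Vector (suc n)
    d = shear (λ i → - X i) ⊙ (1# ∷ X′)

    d-fixed : (upper 1# u B ⊙ d) ≈ᵥ d
    d-fixed = conjugate-fixed X u B (≈ᵥ-trans (⊙-congʳ (1# ∷ X′) g≈g′) (conjugate-fixes X′ u′ B′))

    tail-fixed : (B ⊙ (d ∘ suc)) ≈ᵥ (d ∘ suc)
    tail-fixed i = trans (sym (upper-⊙ 1# u B (d zero) (d ∘ suc) (suc i))) (d-fixed (suc i))

    X≈X′ : X ≈ᵥ X′
    X≈X′ i = sym (-x+y≈0⇒y≈x (begin
      - X i * 1# + X′ i  ≈⟨ shear-⊙ (λ i → - X i) 1# X′ (suc i) ⟨
      d (suc i)          ≈⟨ fixed⇒zero ¬fixed (d ∘ suc) tail-fixed i ⟩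
      0#                 ∎))
      where open import Relation.Binary.Reasoning.Setoid setoid

    H≈H′ : upper 1# u B ≈ₘ upper 1# u′ B′
    H≈H′ = begin
      upper 1# u B                                                 ≈⟨ unconjugate X u B ⟨
      (shear (λ i → - X i) · conjugate X u B) · shear X
        ≈⟨ ·-cong (·-congˡ (shear (λ i → - X i)) g≈g′) (shear-cong X≈X′) ⟩
      (shear (λ i → - X i) · conjugate X′ u′ B′) · shear X′
        ≈⟨ ·-congʳ (shear X′) (·-congʳ (conjugate X′ u′ B′) (shear-cong (λ i → -‿cong (X≈X′ i)))) ⟩
      (shear (λ i → - X′ i) · conjugate X′ u′ B′) · shear X′      ≈⟨ unconjugate X′ u′ B′ ⟩
      upper 1# u′ B′                                               ∎
      where open import Relation.Binary.Reasoning.Setoid (matrixSetoid (suc n))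

  record FreeConjugates (n : ℕ) : Set where
    field
      #free : ℕ
      few-fixed : glCount n ≤ℕ #free +ℕ sBound n
      conjugates : Family (matrixSetoid (suc n)) InS (q ^ n *ℕ (q ^ n *ℕ #free))

  -- Split the family by the existence of a fixed vector: the members with one
  -- lie in S(GL(n, F)), which has a coding below sBound n.
  freeConjugates : ∀ n → FreeConjugates n
  freeConjugates n with partition (glFamily n) HasFixedVector hasFixedVector?
  ... | k , k′ , k+k′≡glCount , free , fixed = record
    { #free = k
    ; few-fixed = ≡.subst (_≤ℕ k +ℕ sBound n) k+k′≡glCount (+-monoʳ-≤ k (family≤coding fixed (sCoding n)))
    ; conjugates = map-family conjugateOf (λ (X , u , _) (_ , _ , B∈GL , _) → conjugate-S X u B∈GL)
        conjugate-reflects (vectors ×-family (vectors ×-family free))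
    }

module Bounds (F : Field) {q : ℕ} (size : FieldOfSize F q) where
  open Field F using (0≉1; 1#; sym)
  open MatrixDefs F
  open Matrices F
  open FiniteField F size using (units; matrixCoding)
  open UpperBoundS F size using (sBound; sCoding)
  open LowerBoundGL F size using (#units; glCount; glFamily)
  open LowerBoundS F size using (FreeConjugates; freeConjugates)
  open Counting
  open Arithmetic
  open import Data.Nat using (_≤?_)
  open import Data.Nat.Properties
    using (≤-trans; ≤-reflexive; *-mono-≤; *-monoʳ-≤; *-monoˡ-≤; ^-monoˡ-≤;
           *-assoc; *-identityʳ; *-distribˡ-+; ^-*-assoc; m≤m+n; m≤n+m; ≰⇒>; <⇒≤; module ≤-Reasoning)
  open import Data.Nat.Tactic.RingSolver using (solve-∀)
  open ≤-Reasoning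

  S-upper : ∀ n {N} → CardS F (suc n) N → N ≤ℕ suc n *ℕ q ^ square-1 n
  S-upper n h = ≤-trans (card≤coding h (sCoding (suc n))) (≤-reflexive (≡.cong (suc n *ℕ_) (^-sBound q n)))

  GL-upper : ∀ n {N} → CardGL F n N → N ≤ℕ q ^ (n *ℕ n)
  GL-upper n h = ≤-trans (card≤coding h (matrixCoding InGL)) (≤-reflexive (^-*-assoc q n n))

  -- q^(n²) ≤ 2^n glCount n, since q ≤ 2 #units.
  glCount-bound : ∀ n → q ^ (n *ℕ n) ≤ℕ 2 ^ n *ℕ glCount n
  glCount-bound zero = s≤s z≤n
  glCount-bound (suc n) = begin
    q *ℕ q ^ square-1 n
      ≡⟨ ≡.cong (q *ℕ_) (^-square-1 q n) ⟩
    q *ℕ (q ^ n *ℕ (q ^ n *ℕ q ^ (n *ℕ n)))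
      ≤⟨ *-mono-≤ (proj₁ (proj₂ units)) (*-monoʳ-≤ (q ^ n) (*-monoʳ-≤ (q ^ n) (glCount-bound n))) ⟩
    2 *ℕ #units *ℕ (q ^ n *ℕ (q ^ n *ℕ (2 ^ n *ℕ glCount n)))
      ≡⟨ rearrange #units (q ^ n) (2 ^ n) (glCount n) ⟩
    2 ^ suc n *ℕ glCount (suc n) ∎
    where
    rearrange : ∀ u a t c → 2 *ℕ u *ℕ (a *ℕ (a *ℕ (t *ℕ c))) ≡ 2 *ℕ t *ℕ (u *ℕ (a *ℕ (a *ℕ c)))
    rearrange = solve-∀

  GL-lower : ∀ n {N} → CardGL F n N → q ^ (n *ℕ n) ≤ℕ 2 ^ n *ℕ N
  GL-lower n h = ≤-trans (glCount-bound n) (*-monoʳ-≤ (2 ^ n) (family≤card (glFamily n) h))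

  sBound-small : ∀ n → threshold n ≤ℕ q → 2 ^ suc n *ℕ sBound n ≤ℕ q ^ (n *ℕ n)
  sBound-small zero _ = z≤n
  sBound-small (suc p) t≤q = begin
    2 ^ suc (suc p) *ℕ (suc p *ℕ (q ^ suc (suc p)) ^ p)  ≡⟨ *-assoc (2 ^ suc (suc p)) (suc p) _ ⟨
    threshold (suc p) *ℕ (q ^ suc (suc p)) ^ p            ≤⟨ *-monoˡ-≤ _ t≤q ⟩
    q *ℕ (q ^ suc (suc p)) ^ p                            ≡⟨ ≡.cong (q *ℕ_) (^-sBound q p) ⟩
    q ^ (suc p *ℕ suc p)                                  ∎

  S-lower-large : ∀ n {N} → threshold n ≤ℕ q → CardS F (suc n) N → q ^ square-1 n ≤ℕ 2 ^ suc n *ℕ N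
  S-lower-large n {N} t≤q h = begin
    q ^ square-1 n                                ≡⟨ ^-square-1 q n ⟩
    q ^ n *ℕ (q ^ n *ℕ q ^ (n *ℕ n))              ≤⟨ *-monoʳ-≤ (q ^ n) (*-monoʳ-≤ (q ^ n) free-many) ⟩
    q ^ n *ℕ (q ^ n *ℕ (2 ^ suc n *ℕ k))          ≡⟨ rearrange (q ^ n) (2 ^ suc n) k ⟩
    2 ^ suc n *ℕ (q ^ n *ℕ (q ^ n *ℕ k))          ≤⟨ *-monoʳ-≤ (2 ^ suc n) (family≤card conjugates h) ⟩
    2 ^ suc n *ℕ N                                ∎
    where
    open FreeConjugates (freeConjugates n) renaming (#free to k)

    rearrange : ∀ a t k → a *ℕ (a *ℕ (t *ℕ k)) ≡ t *ℕ (a *ℕ (a *ℕ k))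
    rearrange = solve-∀

    double : ∀ x → x +ℕ x ≡ 2 *ℕ x
    double = solve-∀

    free-many : q ^ (n *ℕ n) ≤ℕ 2 ^ suc n *ℕ k
    free-many = halve (begin
      q ^ (n *ℕ n) +ℕ q ^ (n *ℕ n)                   ≡⟨ double (q ^ (n *ℕ n)) ⟩
      2 *ℕ q ^ (n *ℕ n)                              ≤⟨ *-monoʳ-≤ 2 (glCount-bound n) ⟩
      2 *ℕ (2 ^ n *ℕ glCount n)                      ≡⟨ *-assoc 2 (2 ^ n) (glCount n) ⟨
      2 ^ suc n *ℕ glCount n                         ≤⟨ *-monoʳ-≤ (2 ^ suc n) few-fixed ⟩
      2 ^ suc n *ℕ (k +ℕ sBound n)                   ≡⟨ *-distribˡ-+ (2 ^ suc n) k (sBound n) ⟩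
      2 ^ suc n *ℕ k +ℕ 2 ^ suc n *ℕ sBound n        ∎) (sBound-small n t≤q)

  S-nonempty : ∀ n {N} → CardS F (suc n) N → 1 ≤ℕ N
  S-nonempty n h = family≤card just-identity h
    where
    identity-S : InS (identity {suc n})
    identity-S = GL-identity , (1# ∷ zeroVec) , (λ e₀≈0 → 0≉1 (sym (e₀≈0 zero))) , ⊙-identity (1# ∷ zeroVec)

    just-identity : Family (matrixSetoid (suc n)) InS 1
    just-identity = family (λ _ → identity) (λ _ → identity-S) λ { zero zero _ → ≡.refl }

  S-lower-small : ∀ n {N} → q ≤ℕ threshold n → CardS F (suc n) N →
    q ^ square-1 n ≤ℕ threshold n ^ square-1 n *ℕ N
  S-lower-small n {N} q≤t h = begin
    q ^ square-1 n                          ≤⟨ ^-monoˡ-≤ (square-1 n) q≤t ⟩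
    threshold n ^ square-1 n                ≡⟨ *-identityʳ _ ⟨
    threshold n ^ square-1 n *ℕ 1           ≤⟨ *-monoʳ-≤ (threshold n ^ square-1 n) (S-nonempty n h) ⟩
    threshold n ^ square-1 n *ℕ N           ∎

  S-lower : ∀ n {N} → CardS F (suc n) N → q ^ square-1 n ≤ℕ K n *ℕ N
  S-lower n {N} h with threshold n ≤? q
  ... | yes t≤q = ≤-trans (S-lower-large n t≤q h) (*-monoˡ-≤ N (m≤m+n (2 ^ suc n) _))
  ... | no t≰q = ≤-trans (S-lower-small n (<⇒≤ (≰⇒> t≰q)) h) (*-monoˡ-≤ N (m≤n+m _ (2 ^ suc n)))

  GL≤K·qS : ∀ n {nS nG} → CardS F (suc n) nS → CardGL F (suc n) nG → nG ≤ℕ K n *ℕ (q *ℕ nS)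
  GL≤K·qS n {nS} {nG} hS hG = begin
    nG                       ≤⟨ GL-upper (suc n) hG ⟩
    q *ℕ q ^ square-1 n      ≤⟨ *-monoʳ-≤ q (S-lower n hS) ⟩
    q *ℕ (K n *ℕ nS)         ≡⟨ swap q (K n) nS ⟩
    K n *ℕ (q *ℕ nS)         ∎
    where
    swap : ∀ a b c → a *ℕ (b *ℕ c) ≡ b *ℕ (a *ℕ c)
    swap = solve-∀

  qS≤c·GL : ∀ n {nS nG} → CardS F (suc n) nS → CardGL F (suc n) nG →
    q *ℕ nS ≤ℕ suc n *ℕ 2 ^ suc n *ℕ nG
  qS≤c·GL n {nS} {nG} hS hG = begin
    q *ℕ nS                              ≤⟨ *-monoʳ-≤ q (S-upper n hS) ⟩
    q *ℕ (suc n *ℕ q ^ square-1 n)       ≡⟨ swap q (suc n) (q ^ square-1 n) ⟩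
    suc n *ℕ q ^ (suc n *ℕ suc n)        ≤⟨ *-monoʳ-≤ (suc n) (GL-lower (suc n) hG) ⟩
    suc n *ℕ (2 ^ suc n *ℕ nG)           ≡⟨ *-assoc (suc n) (2 ^ suc n) nG ⟨
    suc n *ℕ 2 ^ suc n *ℕ nG             ∎
    where
    swap : ∀ a b c → a *ℕ (b *ℕ c) ≡ b *ℕ (a *ℕ c)
    swap = solve-∀

module Rationals where
  open import Data.Integer using (+_)
  import Data.Integer as ℤ
  import Data.Integer.Properties as ℤ
  open import Data.Rational using (ℚ; 0ℚ; 1ℚ; _*_; _/_; _≤_; _<_; mkℚ; 1/_; *≤*)
  open import Data.Rational.Properties
    using (normalize-coprime; ≤-trans; ≤-reflexive; *-monoˡ-≤-nonNeg; *-assoc; *-identityˡ;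
           *-inverseˡ; positive⁻¹; <-≤-trans)
  open import Data.Nat.Properties using (*-monoˡ-≤; n≤1+n) renaming (≤-trans to ≤ℕ-trans)
  open import Data.Nat.Coprimality using (1-coprimeTo) renaming (sym to coprime-sym)

  -- n as the normalised fraction n/1, whose reciprocal is computable.
  fraction : ℕ → ℚ
  fraction n = mkℚ (+ n) 0 (coprime-sym (1-coprimeTo n))

  ℕtoℚ≡fraction : ∀ n → ℕtoℚ n ≡ fraction n
  ℕtoℚ≡fraction n = normalize-coprime (coprime-sym (1-coprimeTo n))

  ℕtoℚ-mono : ∀ {a b} → a ≤ℕ b → ℕtoℚ a ≤ ℕtoℚ b
  ℕtoℚ-mono {a} {b} a≤b rewrite ℕtoℚ≡fraction a | ℕtoℚ≡fraction b =
    *≤* (≡.subst₂ ℤ._≤_ (≡.sym (ℤ.*-identityʳ (+ a))) (≡.sym (ℤ.*-identityʳ (+ b))) (ℤ.+≤+ a≤b))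

  ℕtoℚ-homo-* : ∀ a b → ℕtoℚ a * ℕtoℚ b ≡ ℕtoℚ (a *ℕ b)
  ℕtoℚ-homo-* a b rewrite ℕtoℚ≡fraction a | ℕtoℚ≡fraction b = ≡.cong (_/ 1) (≡.sym (ℤ.pos-* a b))

  ℕtoℚ-positive : ∀ n → 1 ≤ℕ n → 0ℚ < ℕtoℚ n
  ℕtoℚ-positive n n≥1 = <-≤-trans (positive⁻¹ 1ℚ) (ℕtoℚ-mono n≥1)

  inverse1+ : ℕ → ℚ
  inverse1+ K = 1/ fraction (suc K)

  inverse1+-positive : ∀ K → 0ℚ < inverse1+ K
  inverse1+-positive K = positive⁻¹ (inverse1+ K)

  ℕ-bound⇒upper : ∀ K {a b} → a ≤ℕ K *ℕ b → ℕtoℚ a ≤ ℕtoℚ K * ℕtoℚ b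
  ℕ-bound⇒upper K {a} {b} a≤Kb = ≤-trans (ℕtoℚ-mono a≤Kb) (≤-reflexive (≡.sym (ℕtoℚ-homo-* K b)))

  ℕ-bound⇒lower : ∀ K {a b} → a ≤ℕ K *ℕ b → inverse1+ K * ℕtoℚ a ≤ ℕtoℚ b
  ℕ-bound⇒lower K {a} {b} a≤Kb =
    ≤-trans (*-monoˡ-≤-nonNeg (inverse1+ K) (ℕtoℚ-mono (≤ℕ-trans a≤Kb (*-monoˡ-≤ b (n≤1+n K)))))
      (≤-reflexive cancel)
    where
    open ≡.≡-Reasoning
    cancel : inverse1+ K * ℕtoℚ (suc K *ℕ b) ≡ ℕtoℚ b
    cancel = begin
      inverse1+ K * ℕtoℚ (suc K *ℕ b)
        ≡⟨ ≡.cong (inverse1+ K *_) (ℕtoℚ-homo-* (suc K) b) ⟨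
      inverse1+ K * (ℕtoℚ (suc K) * ℕtoℚ b)
        ≡⟨ *-assoc (inverse1+ K) (ℕtoℚ (suc K)) (ℕtoℚ b) ⟨
      inverse1+ K * ℕtoℚ (suc K) * ℕtoℚ b
        ≡⟨ ≡.cong (λ x → inverse1+ K * x * ℕtoℚ b) (ℕtoℚ≡fraction (suc K)) ⟩
      inverse1+ K * fraction (suc K) * ℕtoℚ b
        ≡⟨ ≡.cong (_* ℕtoℚ b) (*-inverseˡ (fraction (suc K))) ⟩
      1ℚ * ℕtoℚ b
        ≡⟨ *-identityˡ (ℕtoℚ b) ⟩
      ℕtoℚ b ∎

open import Data.Rational using (ℚ; 0ℚ; _*_; _≤_; _<_)
open import Data.Nat.Properties using (*-mono-≤; m^n>0)
open Arithmetic using (K)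
open Rationals

-- With r = n + 1 the constants are  c₁ = c₁′ = 1/(1 + K n),  c₂ = r  and
-- c₂′ = r 2^r;  each inequality is one of the bounds of the module Bounds.
lemma5p1 : (r : ℕ) → 1 ≤ℕ r →
    (Σ ℚ λ c₁ → Σ ℚ λ c₂ → (0ℚ < c₁) × (0ℚ < c₂) ×
      ((F : Field) (q nS : ℕ) → FieldOfSize F q → CardS F r nS →
        (c₁ * ℕtoℚ (q ^ (r *ℕ r ∸ 1)) ≤ ℕtoℚ nS) × (ℕtoℚ nS ≤ c₂ * ℕtoℚ (q ^ (r *ℕ r ∸ 1)))))
    ×
    (Σ ℚ λ c₁′ → Σ ℚ λ c₂′ → (0ℚ < c₁′) × (0ℚ < c₂′) ×
      ((F : Field) (q nS nG : ℕ) → FieldOfSize F q → CardS F r nS → CardGL F r nG →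
        (c₁′ * ℕtoℚ nG ≤ ℕtoℚ (q *ℕ nS)) × (ℕtoℚ (q *ℕ nS) ≤ c₂′ * ℕtoℚ nG)))
lemma5p1 (suc n) _ =
  (inverse1+ (K n) , ℕtoℚ (suc n) , inverse1+-positive (K n) , ℕtoℚ-positive (suc n) (s≤s z≤n) ,
    λ F q nS size hS → let open Bounds F size in
      ℕ-bound⇒lower (K n) (S-lower n hS) , ℕ-bound⇒upper (suc n) (S-upper n hS)) ,
  (inverse1+ (K n) , ℕtoℚ (suc n *ℕ 2 ^ suc n) , inverse1+-positive (K n) ,
    ℕtoℚ-positive (suc n *ℕ 2 ^ suc n) (*-mono-≤ {1} {suc n} (s≤s z≤n) (m^n>0 2 (suc n))) ,
    λ F q nS nG size hS hG → let open Bounds F size in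
      ℕ-bound⇒lower (K n) (GL≤K·qS n hS hG) , ℕ-bound⇒upper (suc n *ℕ 2 ^ suc n) (qS≤c·GL n hS hG))
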